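{- Let $G$ be a $C_5$-reseminant graph. Then either $G$ is not regular, or $G$ is $k$-regular on $n$ vertices where $k = 2+3h$ and $n = 5+5h$ for some nonnegative integer $h$.
   Context: All graphs are finite, simple and undirected. $C_5$ is the cycle graph on 5 vertices. For a vertex $w$ of a graph, $N_1[w]$ denotes its closed neighborhood (the vertex $w$ together with all its neighbors). Vertex duplication of a vertex $w$ in a graph $\Gamma$ produces the graph obtained by adding a new vertex $w'$ and joining $w'$ by an edge to every vertex of $N_1[w]$ (so $w'$ is adjacent to $w$ and to all neighbors of $w$). For a graph $\Gamma$, a $\Gamma$-reseminant graph is any graph obtained from $\Gamma$ by performing a finite number (possibly zero) of vertex duplications; the $C_5$-reseminant graphs are called reseminant graphs. A graph is $k$-regular if every vertex has degree $k$. -}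

module Defs where

open import Data.Nat using (ℕ; zero; suc; _+_; _*_; _%_)
open import Data.Fin using (Fin; zero; suc; toℕ)
open import Data.Fin.Properties using () renaming (_≟_ to _≟ᶠ_)
open import Data.Bool using (Bool; true; false; _∨_; if_then_else_)
open import Data.List using (List; map; allFin)
open import Data.Nat.ListAction using (sum)
open import Data.Product using (Σ; ∃; _×_)
open import Relation.Nullary.Decidable using (isYes)
open import Relation.Binary.PropositionalEquality using (_≡_; setoid)
open import Function.Bundles using (Inverse)
import Data.Nat as ℕ

-- A graph on the vertex set Fin n, given by its (decidable) adjacency
-- relation.  All graphs arising below are simple (symmetric, loopless).
Graph : ℕ → Set
Graph n = Fin n → Fin n → Bool

C₅ : Graph 5
C₅ i j = isYes (toℕ j ℕ.≟ suc (toℕ i) % 5) ∨ isYes (toℕ i ℕ.≟ suc (toℕ j) % 5)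

-- Vertex duplication of w: the new vertex w' is `zero`, old vertices are
-- shifted by `suc`.  w' is adjacent exactly to the vertices of N₁[w].
duplicate : ∀ {n} → Graph n → Fin n → Graph (suc n)
duplicate G w zero    zero    = false
duplicate G w zero    (suc v) = isYes (v ≟ᶠ w) ∨ G w v
duplicate G w (suc u) zero    = isYes (u ≟ᶠ w) ∨ G w u
duplicate G w (suc u) (suc v) = G u v

data Duplicated : ∀ {n} → Graph n → Set where
  base : Duplicated C₅
  dup  : ∀ {n} {G : Graph n} → Duplicated G → (w : Fin n) → Duplicated (duplicate G w)

_≅_ : ∀ {m n} → Graph m → Graph n → Set
_≅_ {m} {n} G H =
  Σ (Inverse (setoid (Fin m)) (setoid (Fin n))) λ σ →
    ∀ u v → G u v ≡ H (Inverse.to σ u) (Inverse.to σ v)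

Reseminant : ∀ {n} → Graph n → Set
Reseminant {n} H = ∃ λ m → Σ (Graph m) λ G → Duplicated G × (G ≅ H)

degree : ∀ {n} → Graph n → Fin n → ℕ
degree {n} G u = sum (map (λ v → if G u v then 1 else 0) (allFin n))

_IsRegularOfDegree_ : ∀ {n} → Graph n → ℕ → Set
G IsRegularOfDegree k = ∀ v → degree G v ≡ k

Regular : ∀ {n} → Graph n → Set
Regular G = ∃ λ k → G IsRegularOfDegree k

{-# OPTIONS --safe #-}
-- A reseminant graph is a blow-up of C₅: its vertices split into five nonempty
-- cliques, one for each vertex of C₅, and the cliques of adjacent vertices of C₅
-- are completely joined (duplicating a vertex just enlarges its clique).  If the
-- cliques have sizes a₀, …, a₄, a vertex in clique i has degree
-- a_{i-1} + aᵢ + a_{i+1} − 1.  Regularity makes these cyclic triple sums equal,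
-- which forces all aᵢ to equal some s ≥ 1; then k = 3s − 1 and n = 5s.
module Submission where

open import Defs
open import Data.Bool using (Bool; true; false; not; _∧_; _∨_; if_then_else_)
open import Data.Bool.Properties using (∨-comm)
open import Data.Fin using (Fin; zero; suc; toℕ)
open import Data.Fin.Patterns using (0F; 1F; 2F; 3F; 4F)
open import Data.Fin.Properties using (_≟_; all?)
open import Data.List using (tabulate; []; _∷_)
open import Data.List.Properties using (map-tabulate)
open import Data.Nat using (ℕ; zero; suc; _+_; _*_; _%_; _≤_)
open import Data.Nat.ListAction using (sum)
open import Data.Nat.Properties
  using (+-*-semiring; +-identityʳ; +-assoc; +-comm; +-cancelʳ-≡; *-identityʳ; *-comm;
         *-distribʳ-+; *-suc; m≤m+n; m≤n+m; ≤-trans; m≤n⇒∃[o]m+o≡n)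
open import Data.Nat.Tactic.RingSolver using (solve)
open import Data.Product using (∃; _×_; _,_; map₂)
open import Data.Sum using (_⊎_; inj₁; inj₂)
open import Function using (id; _∘_; mk⇔)
open import Function.Bundles using (Inverse)
open import Relation.Nullary using (¬_; yes; no; does)
open import Relation.Nullary.Decidable using (isYes; isYes≗does; dec-true; dec-false; does-⇔; from-yes)
open import Relation.Binary.PropositionalEquality
import Data.Nat as ℕ
open import Algebra.Properties.Semiring.Sum +-*-semiring
  using (sum-syntax; sum-cong-≗; sum-replicate-zero; ∑-comm; ∑-distrib-+; *-distribʳ-sum)

open ≡-Reasoning

fromBool : Bool → ℕ
fromBool b = if b then 1 else 0

δ : ∀ {n} → Fin n → Fin n → ℕ
δ i j = fromBool (does (i ≟ j))

δ-diag : ∀ {n} (i : Fin n) → δ i i ≡ 1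
δ-diag i = cong fromBool (dec-true (i ≟ i) refl)

∑-tabulate : ∀ {n} (f : Fin n → ℕ) → sum (tabulate f) ≡ ∑[ i < n ] f i
∑-tabulate {zero}  f = refl
∑-tabulate {suc n} f = cong (f zero +_) (∑-tabulate (f ∘ suc))

∑-ones : ∀ n → ∑[ i < n ] 1 ≡ n
∑-ones zero    = refl
∑-ones (suc n) = cong suc (∑-ones n)

term≤∑ : ∀ {n} (f : Fin n → ℕ) i → f i ≤ ∑[ j < n ] f j
term≤∑ f zero    = m≤m+n _ _
term≤∑ f (suc i) = ≤-trans (term≤∑ (f ∘ suc) i) (m≤n+m _ (f zero))

∑-δ : ∀ {n} (i : Fin n) (g : Fin n → ℕ) → ∑[ j < n ] (δ i j * g j) ≡ g i
∑-δ {suc n} zero g =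
  trans (cong₂ _+_ (+-identityʳ (g zero)) (sum-replicate-zero n)) (+-identityʳ (g zero))
∑-δ (suc i) g = ∑-δ i (g ∘ suc)

∑-δ-one : ∀ {n} (i : Fin n) → ∑[ j < n ] δ i j ≡ 1
∑-δ-one i = trans (sum-cong-≗ (λ j → sym (*-identityʳ (δ i j)))) (∑-δ i (λ _ → 1))

degree≡∑ : ∀ {n} (G : Graph n) u → degree G u ≡ ∑[ v < n ] fromBool (G u v)
degree≡∑ {n} G u =
  trans (cong sum (map-tabulate {n = n} id (λ v → fromBool (G u v))))
        (∑-tabulate (λ v → fromBool (G u v)))

closedAdj : ∀ {m} → Graph m → Fin m → Fin m → Bool
closedAdj P i j = does (i ≟ j) ∨ P i j

closedAdj-refl : ∀ {m} (P : Graph m) i → closedAdj P i i ≡ true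
closedAdj-refl P i = cong (_∨ P i i) (dec-true (i ≟ i) refl)

closedAdj-sym : ∀ {m} {P : Graph m} → (∀ i j → P i j ≡ P j i) →
                ∀ i j → closedAdj P i j ≡ closedAdj P j i
closedAdj-sym P-sym i j = cong₂ _∨_ (does-⇔ (mk⇔ sym sym) (i ≟ j) (j ≟ i)) (P-sym i j)

closedWeight : ∀ {m} → Graph m → (Fin m → ℕ) → Fin m → ℕ
closedWeight {m} P a i = ∑[ j < m ] (a j * fromBool (closedAdj P i j))

-- G arises from P by replacing every vertex i of P by a clique, the class of i,
-- and completely joining the cliques of adjacent vertices.
record Blowup {n m} (G : Graph n) (P : Graph m) : Set where
  field
    class            : Fin n → Fin m
    adjacency        : ∀ u v → G u v ≡ not (does (u ≟ v)) ∧ closedAdj P (class u) (class v)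
    class-surjective : ∀ i → ∃ λ u → class u ≡ i

blowup-self : ∀ {m} {P : Graph m} → (∀ i → P i i ≡ false) → Blowup P P
blowup-self {P = P} loopless = record
  { class            = id
  ; adjacency        = adjacency
  ; class-surjective = λ i → i , refl
  }
  where
  adjacency : ∀ u v → P u v ≡ not (does (u ≟ v)) ∧ closedAdj P u v
  adjacency u v with u ≟ v
  ... | yes refl = loopless u
  ... | no _     = refl

blowup-duplicate : ∀ {n m} {G : Graph n} {P : Graph m} → (∀ i j → P i j ≡ P j i) →
                   Blowup G P → ∀ w → Blowup (duplicate G w) P
blowup-duplicate {n} {m} {G} {P} P-sym B w = record
  { class            = class′
  ; adjacency        = adjacency′
  ; class-surjective = λ i → let u , cu≡i = class-surjective i in suc u , cu≡i
  }
  where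
  open Blowup B
  class′ : Fin (suc n) → Fin m
  class′ zero    = class w
  class′ (suc u) = class u
  twin-adjacency : ∀ v → isYes (v ≟ w) ∨ G w v ≡ closedAdj P (class w) (class v)
  twin-adjacency v rewrite isYes≗does (v ≟ w) | adjacency w v with v ≟ w
  ... | yes refl = sym (closedAdj-refl P (class v))
  ... | no v≢w rewrite dec-false (w ≟ v) (v≢w ∘ sym) = refl
  adjacency′ : ∀ u v →
               duplicate G w u v ≡ not (does (u ≟ v)) ∧ closedAdj P (class′ u) (class′ v)
  adjacency′ zero    zero    = refl
  adjacency′ zero    (suc v) = twin-adjacency v
  adjacency′ (suc u) zero    = trans (twin-adjacency u) (closedAdj-sym P-sym (class w) (class u))
  adjacency′ (suc u) (suc v) = adjacency u v

blowup-resp-≅ : ∀ {m n k} {G : Graph m} {H : Graph n} {P : Graph k} →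
                G ≅ H → Blowup G P → Blowup H P
blowup-resp-≅ {G = G} {H} {P} (σ , preserves) B = record
  { class            = class ∘ from
  ; adjacency        = adjacency′
  ; class-surjective = λ i → let u , cu≡i = class-surjective i
                             in to u , trans (cong class (strictlyInverseʳ u)) cu≡i
  }
  where
  open Inverse σ
  open Blowup B
  from-injective : ∀ {x y} → from x ≡ from y → x ≡ y
  from-injective {x} {y} e = trans (sym (strictlyInverseˡ x)) (trans (cong to e) (strictlyInverseˡ y))
  adjacency′ : ∀ u v → H u v ≡ not (does (u ≟ v)) ∧ closedAdj P (class (from u)) (class (from v))
  adjacency′ u v = begin
    H u v                          ≡⟨ cong₂ H (strictlyInverseˡ u) (strictlyInverseˡ v) ⟨
    H (to (from u)) (to (from v))  ≡⟨ preserves (from u) (from v) ⟨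
    G (from u) (from v)            ≡⟨ adjacency (from u) (from v) ⟩
    not (does (from u ≟ from v)) ∧ closedAdj P (class (from u)) (class (from v))
      ≡⟨ cong (λ b → not b ∧ closedAdj P (class (from u)) (class (from v)))
              (does-⇔ (mk⇔ from-injective (cong from)) (from u ≟ from v) (u ≟ v)) ⟩
    not (does (u ≟ v)) ∧ closedAdj P (class (from u)) (class (from v)) ∎

module _ {n m} {G : Graph n} {P : Graph m} (B : Blowup G P) where
  open Blowup B

  classSize : Fin m → ℕ
  classSize j = ∑[ v < n ] δ (class v) j

  ∑-by-class : ∀ (g : Fin m → ℕ) → ∑[ v < n ] g (class v) ≡ ∑[ j < m ] (classSize j * g j)
  ∑-by-class g = begin
    ∑[ v < n ] g (class v)                       ≡⟨ sum-cong-≗ (λ v → ∑-δ (class v) g) ⟨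
    ∑[ v < n ] ∑[ j < m ] (δ (class v) j * g j)  ≡⟨ ∑-comm (λ v j → δ (class v) j * g j) ⟩
    ∑[ j < m ] ∑[ v < n ] (δ (class v) j * g j)
      ≡⟨ sum-cong-≗ (λ j → *-distribʳ-sum (g j) (λ v → δ (class v) j)) ⟨
    ∑[ j < m ] (classSize j * g j)               ∎

  vertex-count : n ≡ ∑[ j < m ] classSize j
  vertex-count = begin
    n                                ≡⟨ ∑-ones n ⟨
    ∑[ v < n ] 1                     ≡⟨ ∑-by-class (λ _ → 1) ⟩
    ∑[ j < m ] (classSize j * 1)     ≡⟨ sum-cong-≗ (λ j → *-identityʳ (classSize j)) ⟩
    ∑[ j < m ] classSize j           ∎

  classSize-nonzero : ∀ j → ∃ λ h → classSize j ≡ suc h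
  classSize-nonzero j with class-surjective j
  ... | u , refl = map₂ sym (m≤n⇒∃[o]m+o≡n
    (subst (_≤ classSize (class u)) (δ-diag (class u)) (term≤∑ (λ v → δ (class v) (class u)) u)))

  adjacency-count : ∀ u v → fromBool (G u v) + δ u v ≡ fromBool (closedAdj P (class u) (class v))
  adjacency-count u v rewrite adjacency u v with u ≟ v
  ... | yes refl = cong fromBool (sym (closedAdj-refl P (class u)))
  ... | no _     = +-identityʳ _

  degree-by-class : ∀ u → degree G u + 1 ≡ closedWeight P classSize (class u)
  degree-by-class u = begin
    degree G u + 1                                  ≡⟨ cong₂ _+_ (degree≡∑ G u) (sym (∑-δ-one u)) ⟩
    ∑[ v < n ] fromBool (G u v) + ∑[ v < n ] δ u v  ≡⟨ ∑-distrib-+ (λ v → fromBool (G u v)) (δ u) ⟨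
    ∑[ v < n ] (fromBool (G u v) + δ u v)           ≡⟨ sum-cong-≗ (adjacency-count u) ⟩
    ∑[ v < n ] fromBool (closedAdj P (class u) (class v))
      ≡⟨ ∑-by-class (λ j → fromBool (closedAdj P (class u) j)) ⟩
    closedWeight P classSize (class u)              ∎

C₅-loopless : ∀ i → C₅ i i ≡ false
C₅-loopless 0F = refl
C₅-loopless 1F = refl
C₅-loopless 2F = refl
C₅-loopless 3F = refl
C₅-loopless 4F = refl

C₅-sym : ∀ i j → C₅ i j ≡ C₅ j i
C₅-sym i j = ∨-comm (isYes (toℕ j ℕ.≟ suc (toℕ i) % 5)) (isYes (toℕ i ℕ.≟ suc (toℕ j) % 5))

duplicated-blowup : ∀ {n} {G : Graph n} → Duplicated G → Blowup G C₅
duplicated-blowup base      = blowup-self C₅-loopless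
duplicated-blowup (dup d w) = blowup-duplicate C₅-sym (duplicated-blowup d) w

reseminant-blowup : ∀ {n} {G : Graph n} → Reseminant G → Blowup G C₅
reseminant-blowup (_ , _ , d , G≅H) = blowup-resp-≅ G≅H (duplicated-blowup d)

next prev : Fin 5 → Fin 5
next 0F = 1F
next 1F = 2F
next 2F = 3F
next 3F = 4F
next 4F = 0F
prev 0F = 4F
prev 1F = 0F
prev 2F = 1F
prev 3F = 2F
prev 4F = 3F

prev-next : ∀ i → prev (next i) ≡ i
prev-next 0F = refl
prev-next 1F = refl
prev-next 2F = refl
prev-next 3F = refl
prev-next 4F = refl

C₅-closedAdj : ∀ i j → fromBool (closedAdj C₅ i j) ≡ δ (prev i) j + δ i j + δ (next i) j
C₅-closedAdj = from-yes (all? λ i → all? λ j →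
  fromBool (closedAdj C₅ i j) ℕ.≟ δ (prev i) j + δ i j + δ (next i) j)

closedWeight-C₅ : ∀ (a : Fin 5 → ℕ) i → closedWeight C₅ a i ≡ a (prev i) + a i + a (next i)
closedWeight-C₅ a i = begin
  ∑[ j < 5 ] (a j * fromBool (closedAdj C₅ i j))                        ≡⟨ sum-cong-≗ expand ⟩
  ∑[ j < 5 ] (pick (prev i) j + pick i j + pick (next i) j)
    ≡⟨ trans (∑-distrib-+ (λ j → pick (prev i) j + pick i j) (pick (next i)))
             (cong (_+ ∑[ j < 5 ] pick (next i) j) (∑-distrib-+ (pick (prev i)) (pick i))) ⟩
  ∑[ j < 5 ] pick (prev i) j + ∑[ j < 5 ] pick i j + ∑[ j < 5 ] pick (next i) j
    ≡⟨ cong₂ _+_ (cong₂ _+_ (∑-δ (prev i) a) (∑-δ i a)) (∑-δ (next i) a) ⟩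
  a (prev i) + a i + a (next i)                                         ∎
  where
  pick : Fin 5 → Fin 5 → ℕ
  pick k j = δ k j * a j
  expand : ∀ j → a j * fromBool (closedAdj C₅ i j) ≡ pick (prev i) j + pick i j + pick (next i) j
  expand j = begin
    a j * fromBool (closedAdj C₅ i j)  ≡⟨ cong (a j *_) (C₅-closedAdj i j) ⟩
    a j * (x + y + z)                  ≡⟨ *-comm (a j) (x + y + z) ⟩
    (x + y + z) * a j                  ≡⟨ *-distribʳ-+ (a j) (x + y) z ⟩
    (x + y) * a j + z * a j            ≡⟨ cong (_+ z * a j) (*-distribʳ-+ (a j) x y) ⟩
    x * a j + y * a j + z * a j        ∎
    where
    x y z : ℕ
    x = δ (prev i) j
    y = δ i j
    z = δ (next i) j

cancel-rotate : ∀ x y z w → x + y + z ≡ y + z + w → x ≡ w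
cancel-rotate x y z w e = +-cancelʳ-≡ (y + z) x w (begin
  x + (y + z)  ≡⟨ +-assoc x y z ⟨
  x + y + z    ≡⟨ e ⟩
  y + z + w    ≡⟨ +-comm (y + z) w ⟩
  w + (y + z)  ∎)

-- Equal sums over consecutive triples make a invariant under i ↦ i + 3,
-- and 3 generates ℤ/5.
constant-of-equal-triples : ∀ {a : Fin 5 → ℕ} {K} → (∀ i → a (prev i) + a i + a (next i) ≡ K) →
                            ∀ i → a i ≡ a 0F
constant-of-equal-triples {a} triple = walk
  where
  shift : ∀ i → a i ≡ a (next (next (next i)))
  shift i = cancel-rotate (a i) (a (next i)) (a (next (next i))) _ (begin
    a i + a (next i) + a (next (next i))
      ≡⟨ cong (λ x → a x + a (next i) + a (next (next i))) (prev-next i) ⟨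
    a (prev (next i)) + a (next i) + a (next (next i))
      ≡⟨ trans (triple (next i)) (sym (triple (next (next i)))) ⟩
    a (prev (next (next i))) + a (next (next i)) + a (next (next (next i)))
      ≡⟨ cong (λ x → a x + a (next (next i)) + a (next (next (next i)))) (prev-next (next i)) ⟩
    a (next i) + a (next (next i)) + a (next (next (next i))) ∎)
  a₂≡a₀ : a 2F ≡ a 0F
  a₂≡a₀ = shift 2F
  a₄≡a₀ : a 4F ≡ a 0F
  a₄≡a₀ = trans (shift 4F) a₂≡a₀
  a₁≡a₀ : a 1F ≡ a 0F
  a₁≡a₀ = trans (shift 1F) a₄≡a₀
  a₃≡a₀ : a 3F ≡ a 0F
  a₃≡a₀ = trans (shift 3F) a₁≡a₀
  walk : ∀ i → a i ≡ a 0F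
  walk 0F = refl
  walk 1F = a₁≡a₀
  walk 2F = a₂≡a₀
  walk 3F = a₃≡a₀
  walk 4F = a₄≡a₀

module _ {n} {G : Graph n} (B : Blowup G C₅) where
  open Blowup B

  degree-C₅-blowup : ∀ u → degree G u + 1 ≡
                     classSize B (prev (class u)) + classSize B (class u) + classSize B (next (class u))
  degree-C₅-blowup u = trans (degree-by-class B u) (closedWeight-C₅ (classSize B) (class u))

  regular⇒balanced : Regular G → ∀ i → classSize B i ≡ classSize B 0F
  regular⇒balanced (k , regular) = constant-of-equal-triples triple
    where
    triple : ∀ i → classSize B (prev i) + classSize B i + classSize B (next i) ≡ k + 1
    triple i with class-surjective i
    ... | u , refl = trans (sym (degree-C₅-blowup u)) (cong (_+ 1) (regular u))

  balanced⇒regular : (∀ i → classSize B i ≡ classSize B 0F) →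
                     ∃ λ h → G IsRegularOfDegree (2 + 3 * h) × n ≡ 5 + 5 * h
  balanced⇒regular balanced with classSize-nonzero B 0F
  ... | h , size₀ = h , regular , count
    where
    size : ∀ i → classSize B i ≡ suc h
    size i = trans (balanced i) size₀
    regular : G IsRegularOfDegree (2 + 3 * h)
    regular u = +-cancelʳ-≡ 1 _ _ (begin
      degree G u + 1                       ≡⟨ degree-C₅-blowup u ⟩
      classSize B (prev (class u)) + classSize B (class u) + classSize B (next (class u))
        ≡⟨ cong₂ _+_ (cong₂ _+_ (size (prev (class u))) (size (class u))) (size (next (class u))) ⟩
      suc h + suc h + suc h                ≡⟨ solve (h ∷ []) ⟩
      2 + 3 * h + 1                        ∎)
    count : n ≡ 5 + 5 * h
    count = begin
      n                          ≡⟨ vertex-count B ⟩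
      ∑[ j < 5 ] classSize B j   ≡⟨ sum-cong-≗ size ⟩
      5 * suc h                  ≡⟨ *-suc 5 h ⟩
      5 + 5 * h                  ∎

mainTheorem1 : (n : ℕ) (G : Graph n) → Reseminant G →
    ¬ Regular G ⊎ (∃ λ h → G IsRegularOfDegree (2 + 3 * h) × n ≡ 5 + 5 * h)
mainTheorem1 n G reseminant with B ← reseminant-blowup reseminant
  with all? (λ i → classSize B i ℕ.≟ classSize B 0F)
... | yes balanced  = inj₂ (balanced⇒regular B balanced)
... | no unbalanced = inj₁ (unbalanced ∘ regular⇒balanced B)
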